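{- Let $G=(V,E,\sigma)$ be a connected signed graph with Gremban expansion $\mathcal{G}$, Gremban involution $\eta$ and projection map $\pi$. Let $V(\mathcal{G})=\mathcal{U}_1\cup\mathcal{U}_2$ be a Gremban-symmetric partition into two sets. Then the cut-set $C(\mathcal{U}_1,\mathcal{U}_2)\subseteq E(\mathcal{G})$ is Gremban-symmetric, and: (i) if $\eta(\mathcal{U}_1)=\mathcal{U}_2$ and $\eta(\mathcal{U}_2)=\mathcal{U}_1$, then $\pi(C(\mathcal{U}_1,\mathcal{U}_2))\subseteq E(G)$ is a frustration set of $G$; (ii) if $\eta(\mathcal{U}_1)=\mathcal{U}_1$ and $\eta(\mathcal{U}_2)=\mathcal{U}_2$, then $\pi(C(\mathcal{U}_1,\mathcal{U}_2))\subseteq E(G)$ is a cut-set of $G$. Conversely, every cut-set and every frustration set $F\subseteq E(G)$ lifts to the Gremban-symmetric cut-set $\pi^{ -1}(F)$ of $\mathcal{G}$ (arising from a Gremban-symmetric partition of $V(\mathcal{G})$), and this correspondence $C\mapsto \pi(C)$, $F\mapsto\pi^{ -1}(F)$ between such Gremban-symmetric cut-sets of $\mathcal{G}$ and the cut-sets and frustration sets of $G$ is a bijection.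
   Context: A signed graph $G=(V,E,\sigma)$ has a finite node set $V$ ($|V|=n$), a finite set $E$ of undirected edges (no self-loops, no multi-edges), and a sign function $\sigma:E\to\{\pm1\}$. The Gremban expansion $\mathcal{G}$ of $G$ is the unsigned graph with node set $\{v^\chi: v\in V,\ \chi\in\{+,-\}\}$ and edge set $\{(u^\chi, v^{\chi\cdot\sigma(u,v)}) : (u,v)\in E,\ \chi\in\{+,-\}\}$ (so a positive edge $uv$ yields $u^+v^+$ and $u^-v^-$; a negative edge yields $u^+v^-$ and $u^-v^+$). The Gremban involution is $\eta(v^\chi)=v^{ -\chi}$, extended to edges by $\eta((a,b))=(\eta(a),\eta(b))$ and to sets elementwise. A node set or edge set $X$ is Gremban-symmetric if $\eta(X)=X$; a partition $V(\mathcal{G})=\mathcal{U}_1\cup\dots\cup\mathcal{U}_k$ is Gremban-symmetric if for each $i$, $\eta(\mathcal{U}_i)=\mathcal{U}_j$ for some $j$. The projection map is $\pi(v^\chi)=v$, extended to edges by $\pi((u^\chi,v^\psi))=(u,v)$ and to sets elementwise. For a partition $V=S\cup T$ of the nodes of a (signed or unsigned) graph, the cut-set is $C(S,T)=\{(u,v)\in E: u\in S, v\in T\}$. A switching function is $\theta:V\to\{\pm1\}$; its frustration set is $F(\theta)=\{uv\in E: \theta(u)\theta(v)\sigma(uv)=-1\}$. A frustration set of $G$ is any set of the form $F(\theta)$. -}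

module Defs where

open import Data.Nat using (ℕ)
open import Data.Fin using (Fin)
open import Data.Bool using (Bool; true; false)
open import Data.Sign using (Sign; opposite; _*_) renaming (+ to pos; - to neg)
open import Data.Product using (Σ; _×_; _,_; proj₁)
open import Data.Sum using (_⊎_)
open import Relation.Binary.PropositionalEquality using (_≡_)
open import Function.Bundles using (_⇔_)

-- A finite signed graph on node set Fin n: simple (symmetric, irreflexive
-- adjacency) with a symmetric sign function (only its values on edges matter).
record SignedGraph (n : ℕ) : Set where
  field
    adj       : Fin n → Fin n → Bool
    adj-sym   : ∀ u v → adj u v ≡ adj v u
    adj-irr   : ∀ v → adj v v ≡ false
    σ         : Fin n → Fin n → Sign
    σ-sym     : ∀ u v → σ u v ≡ σ v u
open SignedGraph public

module _ {n : ℕ} (G : SignedGraph n) where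

  Node : Set
  Node = Fin n

  Edge : Node → Node → Set
  Edge u v = adj G u v ≡ true

  data Reach : Node → Node → Set where
    here : ∀ {v} → Reach v v
    step : ∀ {u w v} → Edge u w → Reach w v → Reach u v

  Connected : Set
  Connected = ∀ u v → Reach u v

  -- (undirected) edge sets of G, as predicates on (ordered) node pairs,
  -- only meaningful on edges
  EdgeSet : Set₁
  EdgeSet = Node → Node → Set

  _≐_ : EdgeSet → EdgeSet → Set
  A ≐ B = ∀ u v → Edge u v → (A u v ⇔ B u v)

  -- a node bipartition V = S ∪ T encoded by its indicator (S = true-part)
  -- cut-set C(S,T): edges with one endpoint in S and the other in T
  cutSet : (Node → Bool) → EdgeSet
  cutSet S u v = (S u ≡ true × S v ≡ false) ⊎ (S u ≡ false × S v ≡ true)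

  IsCutSet : EdgeSet → Set
  IsCutSet F = Σ (Node → Bool) λ S → F ≐ cutSet S

  frust : (Node → Sign) → EdgeSet
  frust θ u v = θ u * θ v * σ G u v ≡ neg

  IsFrustrationSet : EdgeSet → Set
  IsFrustrationSet F = Σ (Node → Sign) λ θ → F ≐ frust θ

  GNode : Set
  GNode = Node × Sign

  GEdge : GNode → GNode → Set
  GEdge (u , χ) (v , ψ) = Edge u v × ψ ≡ χ * σ G u v

  η : GNode → GNode
  η (v , χ) = (v , opposite χ)

  GEdgeSet : Set₁
  GEdgeSet = GNode → GNode → Set

  _≐ᴳ_ : GEdgeSet → GEdgeSet → Set
  A ≐ᴳ B = ∀ a b → GEdge a b → (A a b ⇔ B a b)

  GremSymEdges : GEdgeSet → Set
  GremSymEdges X = (λ a b → X (η a) (η b)) ≐ᴳ X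

  -- cut-set of 𝒢 for a node bipartition U (U₁ = true-part, U₂ = false-part)
  GcutSet : (GNode → Bool) → GEdgeSet
  GcutSet U a b = (U a ≡ true × U b ≡ false) ⊎ (U a ≡ false × U b ≡ true)

  -- η(U_i) = U_j, where U_b = {x | U x ≡ b}
  ImgEq : (GNode → Bool) → Bool → Bool → Set
  ImgEq U i j = ∀ y → (U (η y) ≡ i) ⇔ (U y ≡ j)

  GremSymPartition : (GNode → Bool) → Set
  GremSymPartition U = ∀ i → Σ Bool λ j → ImgEq U i j

  IsGremSymCutSet : GEdgeSet → Set
  IsGremSymCutSet C = Σ (GNode → Bool) λ U → GremSymPartition U × C ≐ᴳ GcutSet U

  proj : GEdgeSet → EdgeSet
  proj C u v = Σ Sign λ χ → Σ Sign λ ψ → GEdge (u , χ) (v , ψ) × C (u , χ) (v , ψ)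

  preim : EdgeSet → GEdgeSet
  preim F a b = F (proj₁ a) (proj₁ b)

-- A Gremban-symmetric bipartition U of 𝒢 either satisfies U ∘ η = U or
-- U ∘ η = not ∘ U (if η fixed neither part nor swapped them, both parts would
-- be mapped into the same part, which is impossible unless 𝒢 is empty).
-- In the first case U(v^χ) = S(v) for a node set S of G; in the second
-- U₁ = {v^θ(v)} for a switching function θ.  An edge u^χ v^(χσ) of 𝒢 is cut
-- by U exactly when uv is cut by S, resp. frustrated by θ, independently of
-- the lift χ; so the cut-set of U is the full preimage π⁻¹(F) of a cut-set or
-- frustration set F, and π, π⁻¹ are mutually inverse on such sets because
-- every edge of G has a lift.
module Submission where

open import Defs
open import Data.Nat using (ℕ)
open import Data.Bool using (Bool; true; false; not)
open import Data.Bool.Properties using (not-involutive)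
open import Data.Sign using (Sign; opposite; _*_) renaming (+ to pos; - to neg)
open import Data.Sign.Properties using (s*s≡+; *-assoc; *-commutativeSemigroup)
open import Algebra.Properties.CommutativeSemigroup *-commutativeSemigroup using (interchange)
open import Data.Empty using (⊥-elim)
open import Data.Product using (Σ; _×_; _,_; proj₁)
open import Data.Sum using (_⊎_; inj₁; inj₂)
open import Function.Bundles using (_⇔_; mk⇔; Equivalence)
open import Function.Construct.Identity using (⇔-id)
open import Function.Construct.Symmetry using (⇔-sym)
open import Function.Construct.Composition using (_⇔-∘_)
open import Relation.Nullary using (¬_; contradiction)
open import Relation.Binary.PropositionalEquality
  using (_≡_; refl; sym; trans; cong; subst; _≗_; module ≡-Reasoning)

open Equivalence using (to; from)

-- cutSet and GcutSet unfold to Apart applied to the indicator values.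
Apart : Bool → Bool → Set
Apart x y = (x ≡ true × y ≡ false) ⊎ (x ≡ false × y ≡ true)

Apart-not : ∀ x y → Apart (not x) (not y) ⇔ Apart x y
Apart-not true  true  = mk⇔ (λ { (inj₁ (() , _)) ; (inj₂ (_ , ())) }) (λ { (inj₁ (_ , ())) ; (inj₂ (() , _)) })
Apart-not true  false = mk⇔ (λ _ → inj₁ (refl , refl)) (λ _ → inj₂ (refl , refl))
Apart-not false true  = mk⇔ (λ _ → inj₂ (refl , refl)) (λ _ → inj₁ (refl , refl))
Apart-not false false = mk⇔ (λ { (inj₁ (_ , ())) ; (inj₂ (() , _)) }) (λ { (inj₁ (() , _)) ; (inj₂ (_ , ())) })

not-≡-⇔ : ∀ x y → (not x ≡ y) ⇔ (x ≡ not y)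
not-≡-⇔ x y = mk⇔ (λ eq → trans (sym (not-involutive x)) (cong not eq))
                  (λ eq → trans (cong not eq) (not-involutive y))

isPos : Sign → Bool
isPos pos = true
isPos neg = false

signOf : Bool → Sign
signOf true  = pos
signOf false = neg

isPos[signOf[b]*pos]≡b : ∀ b → isPos (signOf b * pos) ≡ b
isPos[signOf[b]*pos]≡b true  = refl
isPos[signOf[b]*pos]≡b false = refl

isPos-*-opposite : ∀ s t → isPos (s * opposite t) ≡ not (isPos (s * t))
isPos-*-opposite pos pos = refl
isPos-*-opposite pos neg = refl
isPos-*-opposite neg pos = refl
isPos-*-opposite neg neg = refl

Apart-isPos : ∀ s t → Apart (isPos s) (isPos t) ⇔ (s * t ≡ neg)
Apart-isPos pos pos = mk⇔ (λ { (inj₁ (_ , ())) ; (inj₂ (() , _)) }) (λ ())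
Apart-isPos pos neg = mk⇔ (λ _ → refl) (λ _ → inj₁ (refl , refl))
Apart-isPos neg pos = mk⇔ (λ _ → refl) (λ _ → inj₂ (refl , refl))
Apart-isPos neg neg = mk⇔ (λ { (inj₁ (() , _)) ; (inj₂ (_ , ())) }) (λ ())

*-switch : ∀ a b χ s → (a * χ) * (b * (χ * s)) ≡ a * b * s
*-switch a b χ s = begin
  (a * χ) * (b * (χ * s)) ≡⟨ interchange a χ b (χ * s) ⟩
  a * b * (χ * (χ * s))   ≡⟨ cong (a * b *_) (sym (*-assoc χ χ s)) ⟩
  a * b * (χ * χ * s)     ≡⟨ cong (λ c → a * b * (c * s)) (s*s≡+ χ) ⟩
  a * b * s               ∎
  where open ≡-Reasoning

module _ {n : ℕ} (G : SignedGraph n) where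

  ≐-trans : {A B C : EdgeSet G} → _≐_ G A B → _≐_ G B C → _≐_ G A C
  ≐-trans A≐B B≐C u v e = B≐C u v e ⇔-∘ A≐B u v e

  ≐ᴳ-sym : {X Y : GEdgeSet G} → _≐ᴳ_ G X Y → _≐ᴳ_ G Y X
  ≐ᴳ-sym X≐Y a b e = ⇔-sym (X≐Y a b e)

  ≐ᴳ-trans : {X Y Z : GEdgeSet G} → _≐ᴳ_ G X Y → _≐ᴳ_ G Y Z → _≐ᴳ_ G X Z
  ≐ᴳ-trans X≐Y Y≐Z a b e = Y≐Z a b e ⇔-∘ X≐Y a b e

  proj-cong : {X Y : GEdgeSet G} → _≐ᴳ_ G X Y → _≐_ G (proj G X) (proj G Y)
  proj-cong X≐Y u v _ = mk⇔
    (λ { (χ , ψ , e , x) → χ , ψ , e , to (X≐Y (u , χ) (v , ψ) e) x })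
    (λ { (χ , ψ , e , y) → χ , ψ , e , from (X≐Y (u , χ) (v , ψ) e) y })

  preim-cong : {A B : EdgeSet G} → _≐_ G A B → _≐ᴳ_ G (preim G A) (preim G B)
  preim-cong A≐B (u , _) (v , _) (e , _) = A≐B u v e

  proj-preim : (F : EdgeSet G) → _≐_ G (proj G (preim G F)) F
  proj-preim F u v e = mk⇔ (λ { (_ , _ , _ , f) → f }) (λ f → pos , σ G u v , (e , refl) , f)

  proj-lifted : {X : GEdgeSet G} {F : EdgeSet G} →
    _≐ᴳ_ G X (preim G F) → _≐_ G (proj G X) F
  proj-lifted {F = F} X≐π⁻¹F = ≐-trans (proj-cong X≐π⁻¹F) (proj-preim F)

  preim-proj-lifted : {X : GEdgeSet G} {F : EdgeSet G} →
    _≐ᴳ_ G X (preim G F) → _≐ᴳ_ G (preim G (proj G X)) X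
  preim-proj-lifted X≐π⁻¹F = ≐ᴳ-trans (preim-cong (proj-lifted X≐π⁻¹F)) (≐ᴳ-sym X≐π⁻¹F)

  CutOrFrustrationSet : EdgeSet G → Set
  CutOrFrustrationSet F = IsCutSet G F ⊎ IsFrustrationSet G F

  CutOrFrustrationSet-resp : {A B : EdgeSet G} →
    _≐_ G A B → CutOrFrustrationSet B → CutOrFrustrationSet A
  CutOrFrustrationSet-resp A≐B (inj₁ (S , B≐cut))   = inj₁ (S , ≐-trans A≐B B≐cut)
  CutOrFrustrationSet-resp A≐B (inj₂ (θ , B≐frust)) = inj₂ (θ , ≐-trans A≐B B≐frust)

  liftCut : (Node G → Bool) → GNode G → Bool
  liftCut S a = S (proj₁ a)

  liftSwitch : (Node G → Sign) → GNode G → Bool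
  liftSwitch θ (v , χ) = isPos (θ v * χ)

  GcutSet-cong : {U U′ : GNode G → Bool} → U ≗ U′ → _≐ᴳ_ G (GcutSet G U) (GcutSet G U′)
  GcutSet-cong U≗U′ a b _ rewrite U≗U′ a | U≗U′ b = ⇔-id _

  GcutSet-liftSwitch : (θ : Node G → Sign) →
    _≐ᴳ_ G (GcutSet G (liftSwitch θ)) (preim G (frust G θ))
  GcutSet-liftSwitch θ (u , χ) (v , .(χ * σ G u v)) (_ , refl) =
    subst (λ s → Apart (isPos (θ u * χ)) (isPos (θ v * (χ * σ G u v))) ⇔ (s ≡ neg))
          (*-switch (θ u) (θ v) χ (σ G u v))
          (Apart-isPos (θ u * χ) (θ v * (χ * σ G u v)))

  module _ (U : GNode G → Bool) where

    Symmetric : Set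
    Symmetric = ∀ y → U (η G y) ≡ U y

    Antisymmetric : Set
    Antisymmetric = ∀ y → U (η G y) ≡ not (U y)

    positiveLayer : Node G → Bool
    positiveLayer v = U (v , pos)

    switching : Node G → Sign
    switching v = signOf (positiveLayer v)

    symmetric⇒GremSymPartition : Symmetric → GremSymPartition G U
    symmetric⇒GremSymPartition symm i =
      i , λ y → subst (λ b → (b ≡ i) ⇔ (U y ≡ i)) (sym (symm y)) (⇔-id _)

    antisymmetric⇒GremSymPartition : Antisymmetric → GremSymPartition G U
    antisymmetric⇒GremSymPartition anti i =
      not i , λ y → subst (λ b → (b ≡ i) ⇔ (U y ≡ not i)) (sym (anti y)) (not-≡-⇔ (U y) i)

    ImgEq⇒symmetric : ImgEq G U true true → ImgEq G U false false → Symmetric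
    ImgEq⇒symmetric η₁ η₀ y with U (η G y) in e
    ... | true  = sym (to (η₁ y) e)
    ... | false = sym (to (η₀ y) e)

    ImgEq⇒antisymmetric : ImgEq G U true false → ImgEq G U false true → Antisymmetric
    ImgEq⇒antisymmetric η₁ η₀ y with U (η G y) in e
    ... | true  = cong not (sym (to (η₁ y) e))
    ... | false = cong not (sym (to (η₀ y) e))

    ImgEq⇒constant : ∀ {j} → ImgEq G U true j → ImgEq G U false j → ∀ y → U y ≡ j
    ImgEq⇒constant η₁ η₀ y with U (η G y) in e
    ... | true  = to (η₁ y) e
    ... | false = to (η₀ y) e

    ImgEq-same-image⇒empty : ∀ {j} → ImgEq G U true j → ImgEq G U false j → ¬ GNode G
    ImgEq-same-image⇒empty {j} η₁ η₀ y =
      contradiction (trans (sym (from (η₁ y) Uy≡j)) (from (η₀ y) Uy≡j)) λ ()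
      where
      Uy≡j : U y ≡ j
      Uy≡j = ImgEq⇒constant η₁ η₀ y

    GremSymPartition⇒symmetric⊎antisymmetric : GremSymPartition G U → Symmetric ⊎ Antisymmetric
    GremSymPartition⇒symmetric⊎antisymmetric P with P true | P false
    ... | true  , η₁ | false , η₀ = inj₁ (ImgEq⇒symmetric η₁ η₀)
    ... | false , η₁ | true  , η₀ = inj₂ (ImgEq⇒antisymmetric η₁ η₀)
    ... | true  , η₁ | true  , η₀ = inj₁ (λ y → ⊥-elim (ImgEq-same-image⇒empty η₁ η₀ y))
    ... | false , η₁ | false , η₀ = inj₁ (λ y → ⊥-elim (ImgEq-same-image⇒empty η₁ η₀ y))

    GcutSet-GremSymEdges : Symmetric ⊎ Antisymmetric → GremSymEdges G (GcutSet G U)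
    GcutSet-GremSymEdges (inj₁ symm) a b _ rewrite symm a | symm b = ⇔-id _
    GcutSet-GremSymEdges (inj₂ anti) a b _ rewrite anti a | anti b = Apart-not (U a) (U b)

    symmetric⇒liftCut : Symmetric → U ≗ liftCut positiveLayer
    symmetric⇒liftCut symm (v , pos) = refl
    symmetric⇒liftCut symm (v , neg) = symm (v , pos)

    antisymmetric⇒liftSwitch : Antisymmetric → U ≗ liftSwitch switching
    antisymmetric⇒liftSwitch anti (v , pos) = sym (isPos[signOf[b]*pos]≡b (U (v , pos)))
    antisymmetric⇒liftSwitch anti (v , neg) = begin
      U (v , neg)                    ≡⟨ anti (v , pos) ⟩
      not (U (v , pos))              ≡⟨ cong not (antisymmetric⇒liftSwitch anti (v , pos)) ⟩
      not (isPos (switching v * pos)) ≡⟨ sym (isPos-*-opposite (switching v) pos) ⟩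
      isPos (switching v * neg)      ∎
      where open ≡-Reasoning

    symmetric⇒GcutSet-lifted : Symmetric →
      _≐ᴳ_ G (GcutSet G U) (preim G (cutSet G positiveLayer))
    symmetric⇒GcutSet-lifted symm = GcutSet-cong (symmetric⇒liftCut symm)

    antisymmetric⇒GcutSet-lifted : Antisymmetric →
      _≐ᴳ_ G (GcutSet G U) (preim G (frust G switching))
    antisymmetric⇒GcutSet-lifted anti =
      ≐ᴳ-trans (GcutSet-cong (antisymmetric⇒liftSwitch anti)) (GcutSet-liftSwitch switching)

    GremSymPartition⇒GcutSet-lifted : GremSymPartition G U →
      Σ (EdgeSet G) λ F → CutOrFrustrationSet F × _≐ᴳ_ G (GcutSet G U) (preim G F)
    GremSymPartition⇒GcutSet-lifted P with GremSymPartition⇒symmetric⊎antisymmetric P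
    ... | inj₁ symm = _ , inj₁ (positiveLayer , λ _ _ _ → ⇔-id _) , symmetric⇒GcutSet-lifted symm
    ... | inj₂ anti = _ , inj₂ (switching , λ _ _ _ → ⇔-id _) , antisymmetric⇒GcutSet-lifted anti

  liftSwitch-antisymmetric : (θ : Node G → Sign) → Antisymmetric (liftSwitch θ)
  liftSwitch-antisymmetric θ (v , χ) = isPos-*-opposite (θ v) χ

  CutOrFrustrationSet⇒preim-GcutSet : {F : EdgeSet G} → CutOrFrustrationSet F →
    Σ (GNode G → Bool) λ U → GremSymPartition G U × _≐ᴳ_ G (preim G F) (GcutSet G U)
  CutOrFrustrationSet⇒preim-GcutSet (inj₁ (S , F≐cut)) =
    liftCut S , symmetric⇒GremSymPartition _ (λ _ → refl) , preim-cong F≐cut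
  CutOrFrustrationSet⇒preim-GcutSet (inj₂ (θ , F≐frust)) =
    liftSwitch θ ,
    antisymmetric⇒GremSymPartition _ (liftSwitch-antisymmetric θ) ,
    ≐ᴳ-trans (preim-cong F≐frust) (≐ᴳ-sym (GcutSet-liftSwitch θ))

  GremSymCutSet⇒proj : {C : GEdgeSet G} → IsGremSymCutSet G C →
    CutOrFrustrationSet (proj G C) × _≐ᴳ_ G (preim G (proj G C)) C
  GremSymCutSet⇒proj {C} (U , P , C≐cut) with GremSymPartition⇒GcutSet-lifted U P
  ... | F , isF , cut≐π⁻¹F =
    CutOrFrustrationSet-resp (proj-lifted C≐π⁻¹F) isF , preim-proj-lifted C≐π⁻¹F
    where
    C≐π⁻¹F : _≐ᴳ_ G C (preim G F)
    C≐π⁻¹F = ≐ᴳ-trans C≐cut cut≐π⁻¹F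

theorem2 : {n : ℕ} (G : SignedGraph n) → Connected G →
    ((U : GNode G → Bool) → GremSymPartition G U →
        GremSymEdges G (GcutSet G U)
      × ((ImgEq G U true false × ImgEq G U false true) →
           IsFrustrationSet G (proj G (GcutSet G U)))
      × ((ImgEq G U true true × ImgEq G U false false) →
           IsCutSet G (proj G (GcutSet G U))))
    × ((F : EdgeSet G) → (IsCutSet G F ⊎ IsFrustrationSet G F) →
        Σ (GNode G → Bool) λ U → GremSymPartition G U
          × _≐ᴳ_ G (preim G F) (GcutSet G U))
    × ((C : GEdgeSet G) → IsGremSymCutSet G C →
        (IsCutSet G (proj G C) ⊎ IsFrustrationSet G (proj G C))
          × _≐ᴳ_ G (preim G (proj G C)) C)
    × ((F : EdgeSet G) → (IsCutSet G F ⊎ IsFrustrationSet G F) →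
        IsGremSymCutSet G (preim G F) × _≐_ G (proj G (preim G F)) F)
theorem2 G _ =
  (λ U P →
      GcutSet-GremSymEdges G U (GremSymPartition⇒symmetric⊎antisymmetric G U P) ,
      (λ (η₁ , η₀) → switching G U ,
         proj-lifted G (antisymmetric⇒GcutSet-lifted G U (ImgEq⇒antisymmetric G U η₁ η₀))) ,
      (λ (η₁ , η₀) → positiveLayer G U ,
         proj-lifted G (symmetric⇒GcutSet-lifted G U (ImgEq⇒symmetric G U η₁ η₀)))) ,
  (λ _ → CutOrFrustrationSet⇒preim-GcutSet G) ,
  (λ _ → GremSymCutSet⇒proj G) ,
  (λ F isF → CutOrFrustrationSet⇒preim-GcutSet G isF , proj-preim G F)
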